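{- For every integer $n\geq1$, \[ [n]_q!\,h_n=\sum_{k}q^{k_1+k_2+\cdots+k_r}\frac{[n-1]_q!}{[k_1]_q[k_2]_q\cdots[k_{r-1}]_q\,([k_r]_q!)}\,[p_{n-k_1}]_q[p_{k_1-k_2}]_q\cdots[p_{k_{r-1}-k_r}]_q, \] where the sum is over all sequences of integers $k=(k_1,\dots,k_r)$ with $r\geq1$ and $n-1\geq k_1>k_2>\cdots>k_{r-1}>k_r=0$.
   Context: Let $q$ be an indeterminate and $K$ a field containing $\mathbb{Q}(q)$; $\Lambda_K$ is the algebra of symmetric functions in $x_1,x_2,\dots$ over $K$, $e_n,h_n$ the elementary and complete homogeneous symmetric functions ($e_0=h_0=1$), $E(t)=\sum_{n\ge0}e_nt^n$. $[n]_q=1+q+\cdots+q^{n-1}$ ($n\ge1$), $[0]_q=0$, $[n]_q!=[1]_q\cdots[n]_q$, $[0]_q!=1$. $D_qF(t)=\frac{F(qt)-F(t)}{(q-1)t}$. The $q$-power sums $[p_n]_q\in\Lambda_K$ ($n\ge1$) are defined by $\sum_{n\geq1}[p_n]_q(-t)^{n-1}=D_qE(t)/E(t)$. -}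

module Defs where

open import Algebra.Bundles using (CommutativeRing)
open import Data.Nat using (ℕ; zero; suc; _∸_)
open import Data.List using (List; []; _∷_; _++_; map; foldr; zipWith; upTo)

module _ {c ℓ} (R : CommutativeRing c ℓ) where
  open CommutativeRing R

  -- formal power series in t over R, as coefficient sequences
  Series : Set c
  Series = ℕ → Carrier

  sumR : List Carrier → Carrier
  sumR = foldr _+_ 0#

  prodR : List Carrier → Carrier
  prodR = foldr _*_ 1#

  pow : Carrier → ℕ → Carrier
  pow x zero    = 1#
  pow x (suc n) = x * pow x n

  -- [n]_q = 1 + q + ... + q^(n-1), [0]_q = 0
  qint : Carrier → ℕ → Carrier
  qint q zero    = 0#
  qint q (suc n) = 1# + q * qint q n

  qfact : Carrier → ℕ → Carrier
  qfact q zero    = 1#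
  qfact q (suc n) = qint q (suc n) * qfact q n

  alt : ℕ → Carrier → Carrier
  alt zero    x = x
  alt (suc m) x = - alt m x

  _⋆_ : Series → Series → Series
  (f ⋆ g) m = sumR (map (λ j → f j * g (m ∸ j)) (upTo (suc m)))

  -- coefficients a_m , a_{m-1} , ... , a_0 of 1/f  (for f with constant term 1):
  -- a_0 = 1 ,  a_{m+1} = - Σ_{i=1}^{m+1} f_i a_{m+1-i}
  invList : Series → ℕ → List Carrier
  invList f zero    = 1# ∷ []
  invList f (suc m) =
    (- sumR (zipWith _*_ (map (λ j → f (suc j)) (upTo (suc m))) (invList f m)))
      ∷ invList f m

  hd : List Carrier → Carrier
  hd []      = 0#
  hd (x ∷ _) = x

  -- the series 1/f (f assumed to have constant term 1)
  inv1 : Series → Series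
  inv1 f m = hd (invList f m)

  negArg : Series → Series
  negArg f m = alt m (f m)

  -- q-derivative D_q F(t) = (F(qt) - F(t)) / ((q-1) t); coefficientwise it is
  -- t^m ↦ [m+1]_q F_{m+1}  (since (q^{m+1}-1)/(q-1) = [m+1]_q)
  Dq : Carrier → Series → Series
  Dq q F m = qint q (suc m) * F (suc m)

  -- Given e : ℕ → R (the e_n, with E(t) = Σ e_n t^n):
  -- complete homogeneous h_n, via Σ h_n t^n = 1 / E(-t)
  hfun : Series → ℕ → Carrier
  hfun e = inv1 (negArg e)

  -- q-power sums: Σ_{n≥1} [p_n]_q (-t)^{n-1} = D_q E(t) / E(t).
  -- [p_{m+1}]_q = (-1)^m · (coefficient of t^m in D_q E / E);  qp 0 is unused (set to 0).
  qp : Carrier → Series → ℕ → Carrier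
  qp q e zero    = 0#
  qp q e (suc m) = alt m ((Dq q e ⋆ inv1 e) m)

  -- product [p_{a-k_1}]_q [p_{k_1-k_2}]_q ... [p_{k_{r-1}-0}]_q for ks = (k_1,...,k_{r-1})
  pchain : Carrier → Series → ℕ → List ℕ → Carrier
  pchain q e a []       = qp q e a
  pchain q e a (k ∷ ks) = qp q e (a ∸ k) * pchain q e k ks

-- all strictly decreasing lists (k_1 > k_2 > ... ) with entries in {1,...,m}
-- (each such list listed exactly once)
decSeqs : ℕ → List (List ℕ)
decSeqs zero    = [] ∷ []
decSeqs (suc m) = decSeqs m ++ map (suc m ∷_) (decSeqs m)

{-# OPTIONS --safe #-}
module Submission where

open import Defs
open import Algebra.Bundles using (CommutativeRing)
open import Data.Nat using (ℕ; suc; _∸_; _≤_)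
open import Data.List using (List; map)
open import Data.Nat.ListAction using (sum)

open import Data.Nat using (zero; s≤s; z≤n; _<_)
import Data.Nat as ℕ
open import Data.Nat.Properties using (+-∸-assoc)
open import Data.List using ([]; _∷_; _++_; applyUpTo; zipWith)
open import Data.List.Properties using (map-++; map-∘)
open import Function using (_∘_)
open import Relation.Binary.Bundles using (Setoid)
open import Relation.Binary.PropositionalEquality using (_≡_; cong₂)
import Relation.Binary.PropositionalEquality as ≡
import Algebra.Construct.Pointwise as Pointwise
import Relation.Binary.Reasoning.Setoid

-- Write E(t) = Σ e_n t^n and H(t) = Σ h_n t^n = 1 / E(-t).  The q-Leibniz rule
-- D_q(FG) = D_q F · G + F(qt) · D_q G applied to H(t) E(-t) = 1, together with
-- D_q E(t) / E(t) = Σ [p_{k+1}]_q (-t)^k, gives the q-Newton identity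
-- [m+1]_q h_{m+1} = Σ_{k≤m} q^k h_k [p_{m+1-k}]_q.  Dividing by [k]_q and substituting
-- the identity again for every h_k with k > 0 expands [n]_q h_n into a sum over the
-- chains n > k_1 > ... > k_{r-1} > k_r = 0; multiplying by [n-1]_q! gives the formula.

map-applyUpTo : ∀ {a b} {A : Set a} {B : Set b} (φ : A → B) (f : ℕ → A) n →
                map φ (applyUpTo f n) ≡ applyUpTo (φ ∘ f) n
map-applyUpTo φ f zero    = ≡.refl
map-applyUpTo φ f (suc n) = ≡.cong (φ (f 0) ∷_) (map-applyUpTo φ (f ∘ suc) n)

zipWith-applyUpTo : ∀ {a b c} {A : Set a} {B : Set b} {C : Set c} (_⊗_ : A → B → C)
                    (f : ℕ → A) (g : ℕ → B) n →
                    zipWith _⊗_ (applyUpTo f n) (applyUpTo g n) ≡ applyUpTo (λ i → f i ⊗ g i) n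
zipWith-applyUpTo _⊗_ f g zero    = ≡.refl
zipWith-applyUpTo _⊗_ f g (suc n) = ≡.cong (f 0 ⊗ g 0 ∷_) (zipWith-applyUpTo _⊗_ (f ∘ suc) (g ∘ suc) n)

module _ {c ℓ} (R : CommutativeRing c ℓ) where
  open CommutativeRing R hiding (zero)

  module ≈-Reasoning = Relation.Binary.Reasoning.Setoid setoid

  pow-+ : ∀ x m n → pow R x (m ℕ.+ n) ≈ pow R x m * pow R x n
  pow-+ x zero    n = sym (*-identityˡ _)
  pow-+ x (suc m) n = trans (*-congˡ (pow-+ x m n)) (sym (*-assoc _ _ _))

  module FiniteSums where

    Σ< : (ℕ → Carrier) → ℕ → Carrier
    Σ< φ n = sumR R (applyUpTo φ n)

    sumR-++ : ∀ xs ys → sumR R (xs ++ ys) ≈ sumR R xs + sumR R ys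
    sumR-++ []       ys = sym (+-identityˡ _)
    sumR-++ (x ∷ xs) ys = trans (+-congˡ (sumR-++ xs ys)) (sym (+-assoc _ _ _))

    sumR-map-cong : ∀ {a} {A : Set a} {φ ψ : A → Carrier} → (∀ x → φ x ≈ ψ x) →
                    ∀ xs → sumR R (map φ xs) ≈ sumR R (map ψ xs)
    sumR-map-cong φ≈ψ []       = refl
    sumR-map-cong φ≈ψ (x ∷ xs) = +-cong (φ≈ψ x) (sumR-map-cong φ≈ψ xs)

    *-distribˡ-sumR : ∀ {a} {A : Set a} k (φ : A → Carrier) xs →
                      k * sumR R (map φ xs) ≈ sumR R (map (λ x → k * φ x) xs)
    *-distribˡ-sumR k φ []       = zeroʳ k
    *-distribˡ-sumR k φ (x ∷ xs) = trans (distribˡ k _ _) (+-congˡ (*-distribˡ-sumR k φ xs))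

    sumR-decSeqs-suc : ∀ (φ : List ℕ → Carrier) m →
                       sumR R (map φ (decSeqs (suc m)))
                         ≈ sumR R (map φ (decSeqs m)) + sumR R (map (φ ∘ (suc m ∷_)) (decSeqs m))
    sumR-decSeqs-suc φ m = begin
        sumR R (map φ (decSeqs m ++ map (suc m ∷_) (decSeqs m)))
      ≡⟨ ≡.cong (sumR R) (map-++ φ (decSeqs m) _) ⟩
        sumR R (map φ (decSeqs m) ++ map φ (map (suc m ∷_) (decSeqs m)))
      ≈⟨ sumR-++ (map φ (decSeqs m)) _ ⟩
        sumR R (map φ (decSeqs m)) + sumR R (map φ (map (suc m ∷_) (decSeqs m)))
      ≡⟨ ≡.cong (λ xs → sumR R (map φ (decSeqs m)) + sumR R xs) (≡.sym (map-∘ (decSeqs m))) ⟩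
        sumR R (map φ (decSeqs m)) + sumR R (map (φ ∘ (suc m ∷_)) (decSeqs m))
      ∎
      where open ≈-Reasoning

    Σ<-cong : ∀ {φ ψ} n → (∀ j → j < n → φ j ≈ ψ j) → Σ< φ n ≈ Σ< ψ n
    Σ<-cong zero    φ≈ψ = refl
    Σ<-cong (suc n) φ≈ψ = +-cong (φ≈ψ 0 (s≤s z≤n)) (Σ<-cong n (λ j j<n → φ≈ψ (suc j) (s≤s j<n)))

    Σ<-suc : ∀ φ n → Σ< φ (suc n) ≈ Σ< φ n + φ n
    Σ<-suc φ zero    = +-comm _ _
    Σ<-suc φ (suc n) = trans (+-congˡ (Σ<-suc (φ ∘ suc) n)) (sym (+-assoc _ _ _))

  module PowerSeries where
    open import Algebra.Properties.Ring ring
      using (-‿distribˡ-*; -‿distribʳ-*; -0#≈0#; -‿+-comm; -‿involutive)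
    open import Algebra.Properties.CommutativeSemigroup +-commutativeSemigroup
      using () renaming (interchange to +-interchange)
    open import Algebra.Solver.Ring.NaturalCoefficients.Default commutativeSemiring
      using (solve; _:=_; _:+_; _:*_)
    open FiniteSums

    infix  4 _≋_
    infixl 7 _∙_ _◃_
    infixl 6 _⊕_
    infix  8 ⊝_

    _≋_ : Series R → Series R → Set ℓ
    f ≋ g = ∀ n → f n ≈ g n

    ≋-setoid : Setoid c ℓ
    ≋-setoid = record { isEquivalence = Pointwise.isEquivalence ℕ isEquivalence }

    module ≋-Reasoning = Relation.Binary.Reasoning.Setoid ≋-setoid

    1ₛ : Series R
    1ₛ zero    = 1#
    1ₛ (suc n) = 0#

    0ₛ : Series R
    0ₛ _ = 0#

    _⊕_ : Series R → Series R → Series R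
    (f ⊕ g) n = f n + g n

    ⊝_ : Series R → Series R
    (⊝ f) n = - f n

    ⊝-cong : ∀ {f g} → f ≋ g → ⊝ f ≋ ⊝ g
    ⊝-cong f≋g n = -‿cong (f≋g n)

    ⊝-involutive : ∀ f → ⊝ ⊝ f ≋ f
    ⊝-involutive f n = -‿involutive (f n)

    _◃_ : Carrier → Series R → Series R
    (a ◃ f) n = a * f n

    _∙_ : Series R → Series R → Series R
    (f ∙ g) zero    = f 0 * g 0
    (f ∙ g) (suc n) = f 0 * g (suc n) + (f ∘ suc ∙ g) n

    ∙-as-Σ< : ∀ f g n → (f ∙ g) n ≈ Σ< (λ j → f j * g (n ∸ j)) (suc n)
    ∙-as-Σ< f g zero    = sym (+-identityʳ _)
    ∙-as-Σ< f g (suc n) = +-congˡ (∙-as-Σ< (f ∘ suc) g n)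

    ⋆≈∙ : ∀ f g → _⋆_ R f g ≋ f ∙ g
    ⋆≈∙ f g n = trans (reflexive (≡.cong (sumR R) (map-applyUpTo _ (λ i → i) (suc n))))
                      (sym (∙-as-Σ< f g n))

    ∙-cong : ∀ {f f′ g g′} → f ≋ f′ → g ≋ g′ → f ∙ g ≋ f′ ∙ g′
    ∙-cong f≋f′ g≋g′ zero    = *-cong (f≋f′ 0) (g≋g′ 0)
    ∙-cong f≋f′ g≋g′ (suc n) = +-cong (*-cong (f≋f′ 0) (g≋g′ (suc n))) (∙-cong (f≋f′ ∘ suc) g≋g′ n)

    ∙-congˡ : ∀ {f g g′} → g ≋ g′ → f ∙ g ≋ f ∙ g′
    ∙-congˡ = ∙-cong (λ _ → refl)

    ∙-congʳ : ∀ {f f′ g} → f ≋ f′ → f ∙ g ≋ f′ ∙ g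
    ∙-congʳ f≋f′ = ∙-cong f≋f′ (λ _ → refl)

    ∙-distribʳ-⊕ : ∀ f f′ g → (f ⊕ f′) ∙ g ≋ f ∙ g ⊕ f′ ∙ g
    ∙-distribʳ-⊕ f f′ g zero    = distribʳ (g 0) (f 0) (f′ 0)
    ∙-distribʳ-⊕ f f′ g (suc n) =
      trans (+-cong (distribʳ (g (suc n)) (f 0) (f′ 0)) (∙-distribʳ-⊕ (f ∘ suc) (f′ ∘ suc) g n))
            (+-interchange _ _ _ _)

    ∙-◃ˡ : ∀ a f g → a ◃ f ∙ g ≋ a ◃ (f ∙ g)
    ∙-◃ˡ a f g zero    = *-assoc a (f 0) (g 0)
    ∙-◃ˡ a f g (suc n) =
      trans (+-cong (*-assoc a (f 0) (g (suc n))) (∙-◃ˡ a (f ∘ suc) g n)) (sym (distribˡ a _ _))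

    ∙-⊝ˡ : ∀ f g → ⊝ f ∙ g ≋ ⊝ (f ∙ g)
    ∙-⊝ˡ f g zero    = sym (-‿distribˡ-* (f 0) (g 0))
    ∙-⊝ˡ f g (suc n) =
      trans (+-cong (sym (-‿distribˡ-* (f 0) (g (suc n)))) (∙-⊝ˡ (f ∘ suc) g n)) (-‿+-comm _ _)

    ∙-zeroˡ : ∀ g → 0ₛ ∙ g ≋ 0ₛ
    ∙-zeroˡ g zero    = zeroˡ (g 0)
    ∙-zeroˡ g (suc n) = trans (+-cong (zeroˡ _) (∙-zeroˡ g n)) (+-identityʳ 0#)

    ∙-identityˡ : ∀ g → 1ₛ ∙ g ≋ g
    ∙-identityˡ g zero    = *-identityˡ (g 0)
    ∙-identityˡ g (suc n) = trans (+-cong (*-identityˡ _) (∙-zeroˡ g n)) (+-identityʳ _)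

    ∙-suc-last : ∀ f g n → (f ∙ g) (suc n) ≈ (f ∙ g ∘ suc) n + f (suc n) * g 0
    ∙-suc-last f g zero    = refl
    ∙-suc-last f g (suc n) = trans (+-congˡ (∙-suc-last (f ∘ suc) g n)) (sym (+-assoc _ _ _))

    ∙-comm : ∀ f g → f ∙ g ≋ g ∙ f
    ∙-comm f g zero    = *-comm (f 0) (g 0)
    ∙-comm f g (suc n) =
      trans (+-cong (*-comm (f 0) (g (suc n))) (∙-comm (f ∘ suc) g n))
            (trans (+-comm _ _) (sym (∙-suc-last g f n)))

    ∙-assoc : ∀ f g h → (f ∙ g) ∙ h ≋ f ∙ (g ∙ h)
    ∙-assoc f g h zero    = *-assoc (f 0) (g 0) (h 0)
    ∙-assoc f g h (suc n) = begin
        (f 0 * g 0) * h (suc n) + ((f 0 ◃ g ∘ suc ⊕ f ∘ suc ∙ g) ∙ h) n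
      ≈⟨ +-congˡ (∙-distribʳ-⊕ (f 0 ◃ g ∘ suc) (f ∘ suc ∙ g) h n) ⟩
        (f 0 * g 0) * h (suc n) + ((f 0 ◃ g ∘ suc ∙ h) n + (f ∘ suc ∙ g ∙ h) n)
      ≈⟨ +-congˡ (+-cong (∙-◃ˡ (f 0) (g ∘ suc) h n) (∙-assoc (f ∘ suc) g h n)) ⟩
        (f 0 * g 0) * h (suc n) + (f 0 * (g ∘ suc ∙ h) n + (f ∘ suc ∙ (g ∙ h)) n)
      ≈⟨ regroup _ _ _ _ _ ⟩
        (f ∙ (g ∙ h)) (suc n)
      ∎
      where
      open ≈-Reasoning
      regroup : ∀ a b d x y → (a * b) * d + (a * x + y) ≈ a * (b * d + x) + y
      regroup = solve 5 (λ a b d x y → (a :* b) :* d :+ (a :* x :+ y) := a :* (b :* d :+ x) :+ y) refl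

    ∙-identityʳ : ∀ g → g ∙ 1ₛ ≋ g
    ∙-identityʳ g n = trans (∙-comm g 1ₛ n) (∙-identityˡ g n)

    ∙-⊝ʳ : ∀ f g → f ∙ ⊝ g ≋ ⊝ (f ∙ g)
    ∙-⊝ʳ f g n = trans (∙-comm f (⊝ g) n) (trans (∙-⊝ˡ g f n) (-‿cong (∙-comm g f n)))

    ∙-inverse-unique : ∀ {f g g′} → f ∙ g ≋ 1ₛ → f ∙ g′ ≋ 1ₛ → g ≋ g′
    ∙-inverse-unique {f} {g} {g′} fg≋1 fg′≋1 = begin
        g               ≈⟨ ∙-identityʳ g ⟨
        g ∙ 1ₛ          ≈⟨ ∙-congˡ fg′≋1 ⟨
        g ∙ (f ∙ g′)    ≈⟨ ∙-assoc g f g′ ⟨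
        g ∙ f ∙ g′      ≈⟨ ∙-congʳ (λ n → trans (∙-comm g f n) (fg≋1 n)) ⟩
        1ₛ ∙ g′         ≈⟨ ∙-identityˡ g′ ⟩
        g′              ∎
      where open ≋-Reasoning

    alt-cong : ∀ m {a b} → a ≈ b → alt R m a ≈ alt R m b
    alt-cong zero    a≈b = a≈b
    alt-cong (suc m) a≈b = -‿cong (alt-cong m a≈b)

    alt-+ : ∀ m a b → alt R m (a + b) ≈ alt R m a + alt R m b
    alt-+ zero    a b = refl
    alt-+ (suc m) a b = trans (-‿cong (alt-+ m a b)) (sym (-‿+-comm _ _))

    alt-* : ∀ m a b → alt R m (a * b) ≈ a * alt R m b
    alt-* zero    a b = refl
    alt-* (suc m) a b = trans (-‿cong (alt-* m a b)) (-‿distribʳ-* _ _)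

    alt-0# : ∀ m → alt R m 0# ≈ 0#
    alt-0# zero    = refl
    alt-0# (suc m) = trans (-‿cong (alt-0# m)) -0#≈0#

    negArg-∙ : ∀ f g → negArg R (f ∙ g) ≋ negArg R f ∙ negArg R g
    negArg-∙ f g zero    = refl
    negArg-∙ f g (suc n) = begin
        alt R (suc n) (f 0 * g (suc n) + (f ∘ suc ∙ g) n)
      ≈⟨ alt-+ (suc n) _ _ ⟩
        alt R (suc n) (f 0 * g (suc n)) + - alt R n ((f ∘ suc ∙ g) n)
      ≈⟨ +-cong (alt-* (suc n) _ _) (-‿cong (negArg-∙ (f ∘ suc) g n)) ⟩
        f 0 * negArg R g (suc n) + (⊝ (negArg R (f ∘ suc) ∙ negArg R g)) n
      ≈⟨ +-congˡ (∙-⊝ˡ (negArg R (f ∘ suc)) (negArg R g) n) ⟨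
        (negArg R f ∙ negArg R g) (suc n)
      ∎
      where open ≈-Reasoning

    negArg-1ₛ : negArg R 1ₛ ≋ 1ₛ
    negArg-1ₛ zero    = refl
    negArg-1ₛ (suc n) = alt-0# (suc n)

    invList-as-applyUpTo : ∀ f m → invList R f m ≡ applyUpTo (λ i → inv1 R f (m ∸ i)) (suc m)
    invList-as-applyUpTo f zero    = ≡.refl
    invList-as-applyUpTo f (suc m) = ≡.cong (inv1 R f (suc m) ∷_) (invList-as-applyUpTo f m)

    inv1-suc : ∀ f m → inv1 R f (suc m) ≈ - (f ∘ suc ∙ inv1 R f) m
    inv1-suc f m =
      -‿cong (trans (reflexive (≡.cong (sumR R) terms)) (sym (∙-as-Σ< (f ∘ suc) (inv1 R f) m)))
      where
      terms : zipWith _*_ (map (f ∘ suc) (applyUpTo (λ i → i) (suc m))) (invList R f m)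
              ≡ applyUpTo (λ j → f (suc j) * inv1 R f (m ∸ j)) (suc m)
      terms = ≡.trans (cong₂ (zipWith _*_) (map-applyUpTo (f ∘ suc) (λ i → i) (suc m))
                                           (invList-as-applyUpTo f m))
                      (zipWith-applyUpTo _*_ (f ∘ suc) (λ i → inv1 R f (m ∸ i)) (suc m))

    ∙-inv1 : ∀ f → f 0 ≈ 1# → f ∙ inv1 R f ≋ 1ₛ
    ∙-inv1 f f0≈1 zero    = trans (*-identityʳ _) f0≈1
    ∙-inv1 f f0≈1 (suc n) = begin
        f 0 * inv1 R f (suc n) + x   ≈⟨ +-congʳ (*-cong f0≈1 (inv1-suc f n)) ⟩
        1# * - x + x                 ≈⟨ +-congʳ (*-identityˡ _) ⟩
        - x + x                      ≈⟨ -‿inverseˡ x ⟩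
        0#                           ∎
      where
      open ≈-Reasoning
      x : Carrier
      x = (f ∘ suc ∙ inv1 R f) n

    inv1-∙ : ∀ f → f 0 ≈ 1# → inv1 R f ∙ f ≋ 1ₛ
    inv1-∙ f f0≈1 n = trans (∙-comm (inv1 R f) f n) (∙-inv1 f f0≈1 n)

    negArg-inv1 : ∀ f → f 0 ≈ 1# → negArg R (inv1 R f) ≋ inv1 R (negArg R f)
    negArg-inv1 f f0≈1 = ∙-inverse-unique negArg-f∙negArg-inv1 (∙-inv1 (negArg R f) f0≈1)
      where
      negArg-f∙negArg-inv1 : negArg R f ∙ negArg R (inv1 R f) ≋ 1ₛ
      negArg-f∙negArg-inv1 n = trans (sym (negArg-∙ f (inv1 R f) n))
                                     (trans (alt-cong n (∙-inv1 f f0≈1 n)) (negArg-1ₛ n))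

  module QCalculus (q : Carrier) where
    open import Algebra.Properties.Ring ring using (-‿distribʳ-*; -‿involutive; +-inverseʳ-unique)
    open import Algebra.Solver.Ring.NaturalCoefficients.Default commutativeSemiring
      using (solve; _:=_; _:+_; _:*_; con)
    open PowerSeries

    rescale : Series R → Series R
    rescale f k = pow R q k * f k

    -- F(t) ↦ t D_q F(t).  Unlike D_q it preserves degrees, so its Leibniz rule tDq-∙ goes by
    -- induction on the degree using [n+1]_q = 1 + q [n]_q; note Dq R q f k = tDq f (suc k).
    tDq : Series R → Series R
    tDq f k = qint R q k * f k

    rescale-suc : ∀ f → rescale f ∘ suc ≋ q ◃ rescale (f ∘ suc)
    rescale-suc f k = *-assoc _ _ _

    tDq-suc : ∀ f → tDq f ∘ suc ≋ f ∘ suc ⊕ q ◃ tDq (f ∘ suc)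
    tDq-suc f k = trans (distribʳ _ _ _) (+-cong (*-identityˡ _) (*-assoc _ _ _))

    tDq-∙ : ∀ f g → tDq (f ∙ g) ≋ tDq f ∙ g ⊕ rescale f ∙ tDq g
    tDq-∙ f g zero    = both-zero (f 0) (g 0)
      where
      both-zero : ∀ a b → 0# * (a * b) ≈ 0# * a * b + 1# * a * (0# * b)
      both-zero = solve 2 (λ a b → con 0 :* (a :* b) := con 0 :* a :* b :+ con 1 :* a :* (con 0 :* b)) refl
    tDq-∙ f g (suc n) = begin
        qint R q (suc n) * (f 0 * g (suc n) + x)
      ≈⟨ expand q (qint R q n) (f 0) (g (suc n)) x ⟩
        f 0 * tDq g (suc n) + (x + q * tDq (f ∘ suc ∙ g) n)
      ≈⟨ +-congˡ (+-congˡ (*-congˡ (tDq-∙ (f ∘ suc) g n))) ⟩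
        f 0 * tDq g (suc n) + (x + q * ((tDq (f ∘ suc) ∙ g) n + (rescale (f ∘ suc) ∙ tDq g) n))
      ≈⟨ regroup q _ _ _ _ _ _ ⟩
        (0# * f 0 * g (suc n) + (x + q * (tDq (f ∘ suc) ∙ g) n))
          + (1# * f 0 * tDq g (suc n) + q * (rescale (f ∘ suc) ∙ tDq g) n)
      ≈⟨ +-cong (+-congˡ tDq-tail) (+-congˡ rescale-tail) ⟨
        (tDq f ∙ g ⊕ rescale f ∙ tDq g) (suc n)
      ∎
      where
      open ≈-Reasoning
      x : Carrier
      x = (f ∘ suc ∙ g) n
      expand : ∀ r s a b x → (1# + r * s) * (a * b + x) ≈ a * ((1# + r * s) * b) + (x + r * (s * x))
      expand = solve 5 (λ r s a b x → (con 1 :+ r :* s) :* (a :* b :+ x)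
                                      := a :* ((con 1 :+ r :* s) :* b) :+ (x :+ r :* (s :* x))) refl
      regroup : ∀ r a d x y z w →
                a * d + (x + r * (y + z)) ≈ (0# * a * w + (x + r * y)) + (1# * a * d + r * z)
      regroup = solve 7 (λ r a d x y z w → a :* d :+ (x :+ r :* (y :+ z))
                           := (con 0 :* a :* w :+ (x :+ r :* y)) :+ (con 1 :* a :* d :+ r :* z)) refl
      tDq-tail : (tDq f ∘ suc ∙ g) n ≈ x + q * (tDq (f ∘ suc) ∙ g) n
      tDq-tail = trans (∙-congʳ (tDq-suc f) n)
                       (trans (∙-distribʳ-⊕ (f ∘ suc) _ g n) (+-congˡ (∙-◃ˡ q _ g n)))
      rescale-tail : (rescale f ∘ suc ∙ tDq g) n ≈ q * (rescale (f ∘ suc) ∙ tDq g) n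
      rescale-tail = trans (∙-congʳ (rescale-suc f) n) (∙-◃ˡ q _ _ n)

    tDq-∙-suc : ∀ f g n → (tDq f ∙ g) (suc n) ≈ (Dq R q f ∙ g) n
    tDq-∙-suc f g n = trans (+-congʳ (trans (*-congʳ (zeroˡ _)) (zeroˡ _))) (+-identityˡ _)

    Dq-∙ : ∀ f g → Dq R q (f ∙ g) ≋ Dq R q f ∙ g ⊕ rescale f ∙ Dq R q g
    Dq-∙ f g n = begin
        tDq (f ∙ g) (suc n)
      ≈⟨ tDq-∙ f g (suc n) ⟩
        (tDq f ∙ g) (suc n) + (rescale f ∙ tDq g) (suc n)
      ≈⟨ +-cong (tDq-∙-suc f g n) (∙-comm (rescale f) (tDq g) (suc n)) ⟩
        (Dq R q f ∙ g) n + (tDq g ∙ rescale f) (suc n)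
      ≈⟨ +-congˡ (trans (tDq-∙-suc g (rescale f) n) (∙-comm (Dq R q g) (rescale f) n)) ⟩
        (Dq R q f ∙ g) n + (rescale f ∙ Dq R q g) n
      ∎
      where open ≈-Reasoning

    Dq-cong : ∀ {f g} → f ≋ g → Dq R q f ≋ Dq R q g
    Dq-cong f≋g k = *-congˡ (f≋g (suc k))

    Dq-1ₛ : Dq R q 1ₛ ≋ 0ₛ
    Dq-1ₛ k = zeroʳ _

    Dq-of-inverse : ∀ {f g} → f ∙ g ≋ 1ₛ → rescale f ∙ Dq R q g ≋ ⊝ (Dq R q f ∙ g)
    Dq-of-inverse {f} {g} f∙g≋1 n = +-inverseʳ-unique _ _
      (trans (sym (Dq-∙ f g n)) (trans (Dq-cong f∙g≋1 n) (Dq-1ₛ n)))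

    negArg-Dq : ∀ f → negArg R (Dq R q f) ≋ ⊝ Dq R q (negArg R f)
    negArg-Dq f k =
      trans (alt-* k _ _) (sym (trans (-‿cong (sym (-‿distribʳ-* _ _))) (-‿involutive _)))

  module QNewton (q : Carrier) (e : Series R) (e0≈1 : e 0 ≈ 1#) where
    open PowerSeries
    open QCalculus q

    g h p : Series R
    g = negArg R e
    h = hfun R e
    p k = qp R q e (suc k)

    p≋-Dq-g∙h : p ≋ ⊝ (Dq R q g ∙ h)
    p≋-Dq-g∙h = begin
        p                                          ≈⟨ (λ k → alt-cong k (⋆≈∙ (Dq R q e) (inv1 R e) k)) ⟩
        negArg R (Dq R q e ∙ inv1 R e)             ≈⟨ negArg-∙ (Dq R q e) (inv1 R e) ⟩
        negArg R (Dq R q e) ∙ negArg R (inv1 R e)  ≈⟨ ∙-cong (negArg-Dq e) (negArg-inv1 e e0≈1) ⟩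
        ⊝ Dq R q g ∙ h                             ≈⟨ ∙-⊝ˡ (Dq R q g) h ⟩
        ⊝ (Dq R q g ∙ h)                           ∎
      where open ≋-Reasoning

    q-newton : rescale h ∙ p ≋ Dq R q h
    q-newton = begin
        rescale h ∙ p                      ≈⟨ ∙-congˡ p≋-Dq-g∙h ⟩
        rescale h ∙ ⊝ (Dq R q g ∙ h)       ≈⟨ ∙-⊝ʳ (rescale h) _ ⟩
        ⊝ (rescale h ∙ (Dq R q g ∙ h))     ≈⟨ ⊝-cong (∙-assoc (rescale h) (Dq R q g) h) ⟨
        ⊝ (rescale h ∙ Dq R q g ∙ h)       ≈⟨ ⊝-cong (∙-congʳ (Dq-of-inverse (inv1-∙ g e0≈1))) ⟩
        ⊝ (⊝ (Dq R q h ∙ g) ∙ h)           ≈⟨ ⊝-cong (∙-⊝ˡ (Dq R q h ∙ g) h) ⟩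
        ⊝ ⊝ (Dq R q h ∙ g ∙ h)             ≈⟨ ⊝-involutive _ ⟩
        Dq R q h ∙ g ∙ h                   ≈⟨ ∙-assoc (Dq R q h) g h ⟩
        Dq R q h ∙ (g ∙ h)                 ≈⟨ ∙-congˡ (∙-inv1 g e0≈1) ⟩
        Dq R q h ∙ 1ₛ                      ≈⟨ ∙-identityʳ (Dq R q h) ⟩
        Dq R q h                           ∎
      where open ≋-Reasoning

  module Expansion (q : Carrier) (e : Series R) (e0≈1 : e 0 ≈ 1#)
                   (qinv : ℕ → Carrier) (qinv-inverse : ∀ k → qint R q (suc k) * qinv k ≈ 1#) where
    open import Algebra.Solver.Ring.NaturalCoefficients.Default commutativeSemiring
      using (solve; _:=_; _:*_)
    open FiniteSums
    open PowerSeries using (_∙_; ∙-as-Σ<)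
    open QCalculus q using (rescale)
    open QNewton q e e0≈1 using (h; p; q-newton)

    newtonTerm : ℕ → ℕ → Carrier
    newtonTerm a k = pow R q k * h k * qp R q e (a ∸ k)

    newtonSum : ℕ → ℕ → Carrier
    newtonSum m a = Σ< (newtonTerm a) (suc m)

    chainTerm : ℕ → List ℕ → Carrier
    chainTerm a ks = pow R q (sum ks) * prodR R (map (λ k → qinv (k ∸ 1)) ks) * pchain R q e a ks

    chainSum : ℕ → ℕ → Carrier
    chainSum m a = sumR R (map (chainTerm a) (decSeqs m))

    newtonSum-diagonal : ∀ m → newtonSum m (suc m) ≈ Dq R q h m
    newtonSum-diagonal m = begin
        Σ< (newtonTerm (suc m)) (suc m)            ≈⟨ Σ<-cong (suc m) terms ⟩
        Σ< (λ j → rescale h j * p (m ∸ j)) (suc m) ≈⟨ ∙-as-Σ< (rescale h) p m ⟨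
        (rescale h ∙ p) m                          ≈⟨ q-newton m ⟩
        Dq R q h m                                 ∎
      where
      open ≈-Reasoning
      terms : ∀ j → j < suc m → newtonTerm (suc m) j ≈ rescale h j * p (m ∸ j)
      terms j (s≤s j≤m) = reflexive (≡.cong (λ i → pow R q j * h j * qp R q e i) (+-∸-assoc 1 j≤m))

    stepWeight : ℕ → ℕ → Carrier
    stepWeight a m = pow R q (suc m) * qinv m * qp R q e (a ∸ suc m)

    chainTerm-cons : ∀ a m ks → chainTerm a (suc m ∷ ks) ≈ stepWeight a m * chainTerm (suc m) ks
    chainTerm-cons a m ks = trans (*-congʳ (*-congʳ (pow-+ q (suc m) (sum ks)))) (regroup _ _ _ _ _ _)
      where
      regroup : ∀ x y i j p c → (x * y) * (i * j) * (p * c) ≈ (x * i * p) * (y * j * c)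
      regroup = solve 6 (λ x y i j p c → (x :* y) :* (i :* j) :* (p :* c)
                                        := (x :* i :* p) :* (y :* j :* c)) refl

    stepWeight-Dq : ∀ a m → stepWeight a m * Dq R q h m ≈ newtonTerm a (suc m)
    stepWeight-Dq a m = trans (regroup _ _ _ _ _) (trans (*-congˡ (qinv-inverse m)) (*-identityʳ _))
      where
      regroup : ∀ x i p n y → (x * i * p) * (n * y) ≈ (x * y * p) * (n * i)
      regroup = solve 5 (λ x i p n y → (x :* i :* p) :* (n :* y) := (x :* y :* p) :* (n :* i)) refl

    -- Induction on m for all a at once: the chains through m+1 are m+1 ∷ ks with ks a chain
    -- below m+1, so they contribute stepWeight a m times the diagonal sum, which q-Newton evaluates.
    chainSum≈newtonSum : ∀ m a → chainSum m a ≈ newtonSum m a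
    chainSum≈newtonSum zero    a = refl
    chainSum≈newtonSum (suc m) a = begin
        chainSum (suc m) a
      ≈⟨ sumR-decSeqs-suc (chainTerm a) m ⟩
        chainSum m a + sumR R (map (chainTerm a ∘ (suc m ∷_)) (decSeqs m))
      ≈⟨ +-cong (chainSum≈newtonSum m a) (sumR-map-cong (chainTerm-cons a m) (decSeqs m)) ⟩
        newtonSum m a + sumR R (map (λ ks → stepWeight a m * chainTerm (suc m) ks) (decSeqs m))
      ≈⟨ +-congˡ (*-distribˡ-sumR (stepWeight a m) (chainTerm (suc m)) (decSeqs m)) ⟨
        newtonSum m a + stepWeight a m * chainSum m (suc m)
      ≈⟨ +-congˡ (*-congˡ (trans (chainSum≈newtonSum m (suc m)) (newtonSum-diagonal m))) ⟩
        newtonSum m a + stepWeight a m * Dq R q h m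
      ≈⟨ +-congˡ (stepWeight-Dq a m) ⟩
        newtonSum m a + newtonTerm a (suc m)
      ≈⟨ Σ<-suc (newtonTerm a) (suc m) ⟨
        newtonSum (suc m) a
      ∎
      where open ≈-Reasoning

    chainSum-diagonal : ∀ m → chainSum m (suc m) ≈ Dq R q h m
    chainSum-diagonal m = trans (chainSum≈newtonSum m (suc m)) (newtonSum-diagonal m)

lemma4p5 : ∀ {c ℓ} (R : CommutativeRing c ℓ) → let open CommutativeRing R in
    (q : Carrier) (e : ℕ → Carrier) → e 0 ≈ 1# →
    (qinv : ℕ → Carrier) → (∀ k → qint R q (suc k) * qinv k ≈ 1#) →
    (n : ℕ) → 1 ≤ n →
    qfact R q n * hfun R e n ≈
      sumR R (map (λ ks →
          pow R q (sum ks) * (qfact R q (n ∸ 1) * prodR R (map (λ k → qinv (k ∸ 1)) ks) * 1#)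
            * pchain R q e n ks)
        (decSeqs (n ∸ 1)))
lemma4p5 R q e e0≈1 qinv qinv-inverse (suc m) _ = begin
    qint R q (suc m) * qfact R q m * h (suc m)
  ≈⟨ xy∙z≈y∙xz _ _ _ ⟩
    qfact R q m * Dq R q h m
  ≈⟨ *-congˡ (chainSum-diagonal m) ⟨
    qfact R q m * chainSum m (suc m)
  ≈⟨ *-distribˡ-sumR (qfact R q m) (chainTerm (suc m)) (decSeqs m) ⟩
    sumR R (map (λ ks → qfact R q m * chainTerm (suc m) ks) (decSeqs m))
  ≈⟨ sumR-map-cong (λ ks → regroup _ _ _ _) (decSeqs m) ⟩
    _
  ∎
  where
  open CommutativeRing R hiding (zero)
  open import Algebra.Properties.CommutativeSemigroup *-commutativeSemigroup using (xy∙z≈y∙xz)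
  open import Algebra.Solver.Ring.NaturalCoefficients.Default commutativeSemiring
    using (solve; _:=_; _:*_; con)
  open FiniteSums R
  open ≈-Reasoning R
  open QNewton R q e e0≈1 using (h)
  open Expansion R q e e0≈1 qinv qinv-inverse
  regroup : ∀ f x i c → f * (x * i * c) ≈ x * (f * i * 1#) * c
  regroup = solve 4 (λ f x i c → f :* (x :* i :* c) := x :* (f :* i :* con 1) :* c) refl
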